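{- Each of the following axiom schemata is characteristic of $\mathbf{L_1}$, i.e., the set of theorems generated by all instances of classical tautologies and all instances of that single schema under modus ponens coincides with $\mathbf{L_1}$: (1) $(\mathrm{A_{S1}})$: $(\epsilon ab\wedge\epsilon cd)\supset(\epsilon aa\wedge(\epsilon bc\supset(\epsilon ad\wedge\epsilon ba)))$; (2) $(\mathrm{A_{S2}})$: $(\epsilon ab\wedge\epsilon cd)\supset(\epsilon cc\wedge(\epsilon bc\supset(\epsilon ad\wedge\epsilon ba)))$; (3) $(\mathrm{A_{S3N}})$: $\epsilon ab\supset(\epsilon aa\wedge(\epsilon bc\supset(\epsilon bb\wedge(\epsilon cd\supset(\epsilon ad\wedge\epsilon ba)))))$; (4) $(\mathrm{A_{S3Nd}})$: $\epsilon ab\supset(\epsilon aa\wedge((\epsilon bc\wedge\epsilon cd)\supset(\epsilon ad\wedge\epsilon ba)))$.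
   Context: The language of $\mathbf{L_1}$ has name variables $a,b,c,d,\dots$, the binary predicate $\epsilon$, connectives $\neg,\vee$ (others defined as usual). Formulas: $\epsilon xy$ for name variables $x,y$, closed under $\neg,\vee$. $\mathbf{L_1}$ is the smallest set of formulas containing all instances of classical propositional tautologies, all instances (substituting name variables for $a,b,c$) of (Ax1) $\epsilon ab\supset\epsilon aa$, (Ax2) $(\epsilon ab\wedge\epsilon bc)\supset\epsilon ac$, (Ax3) $(\epsilon ab\wedge\epsilon bc)\supset\epsilon ba$, and closed under modus ponens. Instances of a schema are obtained by uniformly substituting name variables for its name variables. -}

module Defs where

open import Data.Nat using (ℕ)
open import Data.Bool using (Bool; true; false; not; _∨_)
open import Data.Sum using (_⊎_)
open import Data.Product using (_×_; ∃-syntax)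
open import Relation.Binary.PropositionalEquality using (_≡_)

Name : Set
Name = ℕ

data Fm : Set where
  ε   : Name → Name → Fm
  ¬'_ : Fm → Fm
  _∨'_ : Fm → Fm → Fm

infixr 6 _∨'_
infix 7 ¬'_

_⊃_ : Fm → Fm → Fm
A ⊃ B = ¬' A ∨' B
infixr 4 _⊃_

_∧'_ : Fm → Fm → Fm
A ∧' B = ¬' (¬' A ∨' ¬' B)
infixr 5 _∧'_

data PFm : Set where
  var  : ℕ → PFm
  neg  : PFm → PFm
  disj : PFm → PFm → PFm

evalP : (ℕ → Bool) → PFm → Bool
evalP v (var n) = v n
evalP v (neg p) = not (evalP v p)
evalP v (disj p q) = evalP v p ∨ evalP v q

Tautology : PFm → Set
Tautology p = ∀ (v : ℕ → Bool) → evalP v p ≡ true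

substP : (ℕ → Fm) → PFm → Fm
substP σ (var n) = σ n
substP σ (neg p) = ¬' substP σ p
substP σ (disj p q) = substP σ p ∨' substP σ q

TautInstance : Fm → Set
TautInstance A = ∃[ p ] ∃[ σ ] (Tautology p × substP σ p ≡ A)

rename : (Name → Name) → Fm → Fm
rename s (ε x y) = ε (s x) (s y)
rename s (¬' A) = ¬' rename s A
rename s (A ∨' B) = rename s A ∨' rename s B

Instance : Fm → Fm → Set
Instance S A = ∃[ s ] rename s S ≡ A

data Thm (Ax : Fm → Set) : Fm → Set where
  taut : ∀ {A} → TautInstance A → Thm Ax A
  ax   : ∀ {A} → Ax A → Thm Ax A
  mp   : ∀ {A B} → Thm Ax (A ⊃ B) → Thm Ax A → Thm Ax B

a b c d : Name
a = 0
b = 1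
c = 2
d = 3

Ax1 Ax2 Ax3 : Fm
Ax1 = ε a b ⊃ ε a a
Ax2 = (ε a b ∧' ε b c) ⊃ ε a c
Ax3 = (ε a b ∧' ε b c) ⊃ ε b a

L1Ax : Fm → Set
L1Ax A = Instance Ax1 A ⊎ Instance Ax2 A ⊎ Instance Ax3 A

L1 : Fm → Set
L1 = Thm L1Ax

AS1 AS2 AS3N AS3Nd : Fm
AS1 = (ε a b ∧' ε c d) ⊃ (ε a a ∧' (ε b c ⊃ (ε a d ∧' ε b a)))
AS2 = (ε a b ∧' ε c d) ⊃ (ε c c ∧' (ε b c ⊃ (ε a d ∧' ε b a)))
AS3N = ε a b ⊃ (ε a a ∧' (ε b c ⊃ (ε b b ∧' (ε c d ⊃ (ε a d ∧' ε b a)))))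
AS3Nd = ε a b ⊃ (ε a a ∧' ((ε b c ∧' ε c d) ⊃ (ε a d ∧' ε b a)))

Characteristic : Fm → Set
Characteristic S = ∀ (A : Fm) → (Thm (Instance S) A → L1 A) × (L1 A → Thm (Instance S) A)

-- Each schema is a truth-functional consequence of a few instances of Ax1–Ax3
-- (ab ⊃ aa, ab ∧ bc ⊃ ac, ac ∧ cd ⊃ ad, ab ∧ bc ⊃ ba, cd ⊃ cc, bc ⊃ bb), so it
-- lies in L₁.  Conversely Ax1, Ax2 and Ax3 are truth-functional consequences of
-- two or three instances of the schema; for A_S1, say, the instances at
-- (a,b,a,b), (a,b,b,c) and (b,c,b,c).  Both systems are closed under renaming,
-- so deriving the generating schemata suffices.  The truth-functional steps are
-- certified by a truth-table decision procedure for formulas of L₁.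
module Submission where

open import Defs
open import Data.Bool using (Bool; true; false; not; _∧_; _∨_; if_then_else_)
open import Data.Bool.Properties using (∧-conicalˡ; ∧-conicalʳ)
open import Data.Nat using (ℕ; zero; suc; _≟_)
open import Data.Product using (_×_; _,_)
open import Data.Product.Properties using (≡-dec)
open import Data.Sum using (inj₁; inj₂)
open import Data.List using (List; []; _∷_; _++_; map; deduplicate)
open import Data.List.Membership.Propositional using (_∈_)
open import Data.List.Membership.Propositional.Properties using (∈-++⁺ˡ; ∈-++⁺ʳ; ∈-deduplicate⁺)
open import Data.List.Relation.Binary.Subset.Propositional using (_⊆_)
open import Data.List.Relation.Unary.All as All using (All; []; _∷_)
open import Data.List.Relation.Unary.All.Properties using (map⁺)
open import Data.List.Relation.Unary.Any using (here; there)
open import Relation.Binary.Definitions using (DecidableEquality)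
open import Relation.Nullary using (yes; no; does; contradiction)
open import Relation.Binary.PropositionalEquality
  using (_≡_; refl; sym; trans; cong; cong₂)

Atom : Set
Atom = Name × Name

_≟ₐ_ : DecidableEquality Atom
_≟ₐ_ = ≡-dec _≟_ _≟_

atoms : Fm → List Atom
atoms (ε x y) = (x , y) ∷ []
atoms (¬' A) = atoms A
atoms (A ∨' B) = atoms A ++ atoms B

Valuation : Set
Valuation = Atom → Bool

evalFm : Valuation → Fm → Bool
evalFm ν (ε x y) = ν (x , y)
evalFm ν (¬' A) = not (evalFm ν A)
evalFm ν (A ∨' B) = evalFm ν A ∨ evalFm ν B

Valid : Fm → Set
Valid A = ∀ ν → evalFm ν A ≡ true

evalFm-local : ∀ {ν μ} A → (∀ {t} → t ∈ atoms A → ν t ≡ μ t) → evalFm ν A ≡ evalFm μ A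
evalFm-local (ε x y) agree = agree (here refl)
evalFm-local (¬' A) agree = cong not (evalFm-local A agree)
evalFm-local (A ∨' B) agree =
  cong₂ _∨_ (evalFm-local A (λ t∈A → agree (∈-++⁺ˡ t∈A)))
            (evalFm-local B (λ t∈B → agree (∈-++⁺ʳ (atoms A) t∈B)))

position : Atom → List Atom → ℕ
position t [] = 0
position t (u ∷ us) = if does (t ≟ₐ u) then 0 else suc (position t us)

-- The default ε 0 0 is never reached on positions of listed atoms.
atomAt : List Atom → ℕ → Fm
atomAt [] _ = ε 0 0
atomAt ((x , y) ∷ us) zero = ε x y
atomAt (u ∷ us) (suc n) = atomAt us n

atomAt-position : ∀ {x y us} → (x , y) ∈ us → atomAt us (position (x , y) us) ≡ ε x y
atomAt-position {x} {y} {u ∷ us} x,y∈u∷us with (x , y) ≟ₐ u | x,y∈u∷us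
... | yes refl | _ = refl
... | no x,y≢u | here x,y≡u = contradiction x,y≡u x,y≢u
... | no _ | there x,y∈us = atomAt-position x,y∈us

skeleton : List Atom → Fm → PFm
skeleton us (ε x y) = var (position (x , y) us)
skeleton us (¬' A) = neg (skeleton us A)
skeleton us (A ∨' B) = disj (skeleton us A) (skeleton us B)

substP-skeleton : ∀ {us} A → atoms A ⊆ us → substP (atomAt us) (skeleton us A) ≡ A
substP-skeleton (ε x y) A⊆us = atomAt-position (A⊆us (here refl))
substP-skeleton (¬' A) A⊆us = cong ¬'_ (substP-skeleton A A⊆us)
substP-skeleton (A ∨' B) A∨B⊆us =
  cong₂ _∨'_ (substP-skeleton A (λ t∈A → A∨B⊆us (∈-++⁺ˡ t∈A)))
             (substP-skeleton B (λ t∈B → A∨B⊆us (∈-++⁺ʳ (atoms A) t∈B)))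

evalP-skeleton : ∀ v us A → evalP v (skeleton us A) ≡ evalFm (λ t → v (position t us)) A
evalP-skeleton v us (ε x y) = refl
evalP-skeleton v us (¬' A) = cong not (evalP-skeleton v us A)
evalP-skeleton v us (A ∨' B) = cong₂ _∨_ (evalP-skeleton v us A) (evalP-skeleton v us B)

valid⇒tautInstance : ∀ {A} → Valid A → TautInstance A
valid⇒tautInstance {A} valid =
  skeleton (atoms A) A , atomAt (atoms A) ,
  (λ v → trans (evalP-skeleton v (atoms A) A) (valid _)) ,
  substP-skeleton A (λ t∈A → t∈A)

_[_≔_] : Valuation → Atom → Bool → Valuation
(ν [ t ≔ β ]) u = if does (u ≟ₐ t) then β else ν u

_↾_ : Valuation → List Atom → Valuation
ν ↾ [] = λ _ → false
ν ↾ (t ∷ ts) = (ν ↾ ts) [ t ≔ ν t ]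

↾-agrees : ∀ ν {t ts} → t ∈ ts → (ν ↾ ts) t ≡ ν t
↾-agrees ν {t} {u ∷ ts} t∈u∷ts with t ≟ₐ u | t∈u∷ts
... | yes refl | _ = refl
... | no t≢u | here t≡u = contradiction t≡u t≢u
... | no _ | there t∈ts = ↾-agrees ν t∈ts

everyValuation : List Atom → (Valuation → Bool) → Bool
everyValuation [] f = f (λ _ → false)
everyValuation (t ∷ ts) f =
  everyValuation ts (λ ν → f (ν [ t ≔ true ])) ∧ everyValuation ts (λ ν → f (ν [ t ≔ false ]))

everyValuation-sound : ∀ ts f → everyValuation ts f ≡ true → ∀ ν → f (ν ↾ ts) ≡ true
everyValuation-sound [] f holds ν = holds
everyValuation-sound (t ∷ ts) f holds ν with ν t
... | true = everyValuation-sound ts _ (∧-conicalˡ _ _ holds) ν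
... | false = everyValuation-sound ts _ (∧-conicalʳ _ _ holds) ν

isValid : Fm → Bool
isValid A = everyValuation (deduplicate _≟ₐ_ (atoms A)) (λ ν → evalFm ν A)

isValid-sound : ∀ A → isValid A ≡ true → Valid A
isValid-sound A valid ν =
  trans (evalFm-local A (λ t∈A → sym (↾-agrees ν (∈-deduplicate⁺ _≟ₐ_ t∈A))))
        (everyValuation-sound (deduplicate _≟ₐ_ (atoms A)) (λ μ → evalFm μ A) valid ν)

_⇛_ : List Fm → Fm → Fm
[] ⇛ A = A
(P ∷ Ps) ⇛ A = P ⊃ (Ps ⇛ A)

infixr 3 _⇛_

mp* : ∀ {Ax Ps A} → Thm Ax (Ps ⇛ A) → All (Thm Ax) Ps → Thm Ax A
mp* ⊢Ps⇛A [] = ⊢Ps⇛A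
mp* ⊢Ps⇛A (⊢P ∷ ⊢Ps) = mp* (mp ⊢Ps⇛A ⊢P) ⊢Ps

tautologicalConsequence : ∀ {Ax Ps A} → All (Thm Ax) Ps → isValid (Ps ⇛ A) ≡ true → Thm Ax A
tautologicalConsequence {Ps = Ps} {A} ⊢Ps valid =
  mp* (taut (valid⇒tautInstance (isValid-sound (Ps ⇛ A) valid))) ⊢Ps

RenamingClosed : (Fm → Set) → Set
RenamingClosed Ax = ∀ s {A} → Ax A → Ax (rename s A)

rename-∘ : ∀ s r A → rename s (rename r A) ≡ rename (λ x → s (r x)) A
rename-∘ s r (ε x y) = refl
rename-∘ s r (¬' A) = cong ¬'_ (rename-∘ s r A)
rename-∘ s r (A ∨' B) = cong₂ _∨'_ (rename-∘ s r A) (rename-∘ s r B)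

rename-substP : ∀ s σ p → rename s (substP σ p) ≡ substP (λ n → rename s (σ n)) p
rename-substP s σ (var n) = refl
rename-substP s σ (neg p) = cong ¬'_ (rename-substP s σ p)
rename-substP s σ (disj p q) = cong₂ _∨'_ (rename-substP s σ p) (rename-substP s σ q)

tautInstance-rename : RenamingClosed TautInstance
tautInstance-rename s (p , σ , taut-p , refl) = p , (λ n → rename s (σ n)) , taut-p , sym (rename-substP s σ p)

instance-rename : ∀ S → RenamingClosed (Instance S)
instance-rename S s (r , refl) = (λ x → s (r x)) , sym (rename-∘ s r S)

L1Ax-rename : RenamingClosed L1Ax
L1Ax-rename s (inj₁ i) = inj₁ (instance-rename Ax1 s i)
L1Ax-rename s (inj₂ (inj₁ i)) = inj₂ (inj₁ (instance-rename Ax2 s i))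
L1Ax-rename s (inj₂ (inj₂ i)) = inj₂ (inj₂ (instance-rename Ax3 s i))

Thm-rename : ∀ {Ax} → RenamingClosed Ax → RenamingClosed (Thm Ax)
Thm-rename closed s (taut t) = taut (tautInstance-rename s t)
Thm-rename closed s (ax α) = ax (closed s α)
Thm-rename closed s (mp ⊢A⊃B ⊢A) = mp (Thm-rename closed s ⊢A⊃B) (Thm-rename closed s ⊢A)

Thm-bind : ∀ {Ax Ax′} → (∀ {A} → Ax A → Thm Ax′ A) → ∀ {A} → Thm Ax A → Thm Ax′ A
Thm-bind f (taut t) = taut t
Thm-bind f (ax α) = f α
Thm-bind f (mp ⊢A⊃B ⊢A) = mp (Thm-bind f ⊢A⊃B) (Thm-bind f ⊢A)

Thm-instance : ∀ {Ax S A} → RenamingClosed Ax → Thm Ax S → Instance S A → Thm Ax A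
Thm-instance closed ⊢S (s , refl) = Thm-rename closed s ⊢S

L1-schemata : List Fm
L1-schemata = Ax1 ∷ Ax2 ∷ Ax3 ∷ []

characteristic : ∀ S → L1 S → All (Thm (Instance S)) L1-schemata → Characteristic S
characteristic S ⊢S (⊢Ax1 ∷ ⊢Ax2 ∷ ⊢Ax3 ∷ []) A =
  Thm-bind (Thm-instance L1Ax-rename ⊢S) ,
  Thm-bind λ { (inj₁ i) → Thm-instance (instance-rename S) ⊢Ax1 i
             ; (inj₂ (inj₁ i)) → Thm-instance (instance-rename S) ⊢Ax2 i
             ; (inj₂ (inj₂ i)) → Thm-instance (instance-rename S) ⊢Ax3 i }

⟨_,_,_,_⟩ : Name → Name → Name → Name → Name → Name
⟨ x , y , z , w ⟩ 0 = x
⟨ x , y , z , w ⟩ 1 = y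
⟨ x , y , z , w ⟩ 2 = z
⟨ x , y , z , w ⟩ 3 = w
⟨ x , y , z , w ⟩ n = n

L1-facts : All L1 ( (ε a b ⊃ ε a a)
                  ∷ ((ε a b ∧' ε b c) ⊃ ε a c)
                  ∷ ((ε a c ∧' ε c d) ⊃ ε a d)
                  ∷ ((ε a b ∧' ε b c) ⊃ ε b a)
                  ∷ (ε c d ⊃ ε c c)
                  ∷ (ε b c ⊃ ε b b)
                  ∷ [])
L1-facts = ax (inj₁ (⟨ a , b , c , d ⟩ , refl))
         ∷ ax (inj₂ (inj₁ (⟨ a , b , c , d ⟩ , refl)))
         ∷ ax (inj₂ (inj₁ (⟨ a , c , d , d ⟩ , refl)))
         ∷ ax (inj₂ (inj₂ (⟨ a , b , c , d ⟩ , refl)))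
         ∷ ax (inj₁ (⟨ c , d , c , d ⟩ , refl))
         ∷ ax (inj₁ (⟨ b , c , c , d ⟩ , refl))
         ∷ []

instancesAt : Fm → List (Name → Name) → List Fm
instancesAt S rs = map (λ r → rename r S) rs

L1-schemata-from : ∀ S rs → All (λ A → isValid (instancesAt S rs ⇛ A) ≡ true) L1-schemata
                 → All (Thm (Instance S)) L1-schemata
L1-schemata-from S rs = All.map (tautologicalConsequence (map⁺ (All.universal (λ r → ax (r , refl)) rs)))

proposition6p1 : Characteristic AS1 × Characteristic AS2 × Characteristic AS3N × Characteristic AS3Nd
proposition6p1 =
  characteristic AS1 (tautologicalConsequence L1-facts refl)
    (L1-schemata-from AS1 (⟨ a , b , a , b ⟩ ∷ ⟨ a , b , b , c ⟩ ∷ ⟨ b , c , b , c ⟩ ∷ [])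
      (refl ∷ refl ∷ refl ∷ [])) ,
  characteristic AS2 (tautologicalConsequence L1-facts refl)
    (L1-schemata-from AS2 (⟨ a , b , a , b ⟩ ∷ ⟨ a , b , b , c ⟩ ∷ [])
      (refl ∷ refl ∷ refl ∷ [])) ,
  characteristic AS3N (tautologicalConsequence L1-facts refl)
    (L1-schemata-from AS3N (⟨ a , b , c , c ⟩ ∷ ⟨ a , b , b , c ⟩ ∷ ⟨ b , c , c , c ⟩ ∷ [])
      (refl ∷ refl ∷ refl ∷ [])) ,
  characteristic AS3Nd (tautologicalConsequence L1-facts refl)
    (L1-schemata-from AS3Nd (⟨ a , b , c , c ⟩ ∷ ⟨ a , b , b , c ⟩ ∷ ⟨ b , c , c , c ⟩ ∷ [])
      (refl ∷ refl ∷ refl ∷ []))
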